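{- Let $d_i(t)$ and $d'_i(t)$, $d''_i(t)$ ($i\in\mathbb Z$, $t\ge 0$) be the even-index and odd-index Fibonacci partition numbers defined in the context. Then for every integer $t\ge 1$: (1) $d'_i(t)=d_i(t)-d_{i-1}(t-1)$ for all $i\in\mathbb Z$; (2) $d''_i(t)=d_{i+1}(t)-d_{i+1}(t-1)$ for all $i\in\mathbb Z$; (3) $d_i(t-1)=d'_{i+1}(t)-d'_{i+1}(t-1)$ for all integers $i\le \frac{t-2}{2}$; (4) $d_i(t-1)=d''_i(t)-d''_{i-1}(t-1)$ for all integers $i\le \frac{t-2}{2}$; (5) $d_i(t-1)=d'_i(t)-d''_{i-2}(t-1)$ for all integers $i\le \frac{t}{2}$.
   Context: Even-index numbers: for integers $t\ge 0$ and $0\le i\le t/2$ define $d_i(t)$ recursively by $d_0(t)=1$ for all $t\ge0$; for $i\ge1$ and $2i<t$: $d_i(t)=2d_{i-1}(t-1)+d_i(t-1)-d_{i-1}(t-2)$; for $i\ge 1$: $d_i(2i)=3d_{i-1}(2i-1)-d_{i-1}(2i-2)$. Extend to all $i\in\mathbb Z$ by $d_i(t)=0$ for $i<0$ and $d_i(t)=d_{t-i}(t)$ for $i>t/2$ (so $d_i(t)=d_{t-i}(t)$ for all $i$, and $d_i(t)=0$ for $i>t$). Odd-index numbers: let $V$ be the set of pairs $(i,t)$ of integers with either $(i,t)=(0,0)$ or $0\le i\le t-1$. Define $d'_i(t)$ for $(i,t)\in V$ by: $d'_0(t)=1$ for all $t\ge 0$; $d'_{t-1}(t)=1$ for all $t\ge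 3$; for all other $(i,t)\in V$ (i.e. $1\le i\le t-2$, or $(i,t)=(1,2)$), recursively in $t$: if $2i\le t$ then $d'_i(t)=2d'_{i-1}(t-1)+d'_i(t-1)-d'_{i-1}(t-2)$, and if $2i\ge t+1$ then $d'_i(t)=d'_{i-1}(t-1)+2d'_i(t-1)-d'_{i-1}(t-2)$. Set $d'_i(t)=0$ for all integers $i$, $t\ge0$ with $(i,t)\notin V$, and define $d''_i(t)=d'_{t-1-i}(t)$ for all $i\in\mathbb Z$, $t\ge 0$ (so $d''_i(t)=0$ for $i<0$ except $d''_{ -1}(0)=1$). For example, row $t=5$ of $d'$ reads $1,4,8,5,1$. -}

module Defs where

open import Data.Bool using (Bool; true; false; if_then_else_; _∧_; not)
open import Data.Nat as ℕ using (ℕ; zero; suc)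
open import Data.Integer using (ℤ; +_; _+_; _-_; _*_; _≤ᵇ_)

infix 4 _==_
_==_ : ℤ → ℤ → Bool
a == b = (a ≤ᵇ b) ∧ (b ≤ᵇ a)

-- Even-index numbers.  d t i  stands for  d_i(t)  (t : ℕ, i : ℤ).
-- dc t i implements the defining recursion, used only for 0 ≤ i ≤ t/2;
-- d t i extends by 0 for i < 0 or i > t and by symmetry d_i(t) = d_{t-i}(t).
mutual
  d : ℕ → ℤ → ℤ
  d t i =
    if not (+ 0 ≤ᵇ i) then + 0
    else if not (i ≤ᵇ + t) then + 0
    else if (+ 2 * i ≤ᵇ + t) then dc t i
    else dc t (+ t - i)

  dc : ℕ → ℤ → ℤ
  dc zero i = + 1
  dc (suc zero) i = + 1
  dc (suc (suc t)) i =
    if (i == + 0) then + 1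
    else if (+ 2 * i ≤ᵇ + suc t)   -- i.e. 2i < t+2
      then + 2 * d (suc t) (i - + 1) + d (suc t) i - d t (i - + 1)
      else + 3 * d (suc t) (i - + 1) - d t (i - + 1)   -- case 2i = t+2

-- Odd-index numbers.  d′ t i  stands for  d'_i(t).
-- Membership in V: (i,t) = (0,0) or 0 ≤ i ≤ t-1; outside V the value is 0.
d′ : ℕ → ℤ → ℤ
d′ t i =
  if (i == + 0) then + 1
  else if not (+ 0 ≤ᵇ i) then + 0
  else if not (i ≤ᵇ + t - + 1) then + 0
  else rec t i
  where
  rec : ℕ → ℤ → ℤ                               -- here 1 ≤ i ≤ t-1
  rec zero i = + 0                              -- impossible
  rec (suc zero) i = + 0                        -- impossible
  rec (suc (suc t′)) i =
    if ((+ 3 ≤ᵇ + suc (suc t′)) ∧ (i == + suc t′)) then + 1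
    else if (+ 2 * i ≤ᵇ + suc (suc t′))
      then + 2 * d′ (suc t′) (i - + 1) + d′ (suc t′) i - d′ t′ (i - + 1)
      else d′ (suc t′) (i - + 1) + + 2 * d′ (suc t′) i - d′ t′ (i - + 1)

d″ : ℕ → ℤ → ℤ
d″ t i = d′ t (+ t - + 1 - i)

module Submission where

-- Write Δd_i(s) = d_i(s+1) - d_{i-1}(s), so part (1) says
-- d′_i(t) = Δd_i(t-1).  We first establish the basic structure of d: the
-- branches of its definition, the symmetry d_i(t) = d_{t-i}(t) for all
-- integers i (d vanishes outside 0 ≤ i ≤ t), and from these the defining
-- recurrence of d as an identity valid for every integer i in the lower half
-- 2i ≤ t, together with its mirror image in the upper half 2i ≥ t.  Linear
-- combinations of these show that Δd satisfies exactly the two recurrences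
-- defining d′, and it has the same boundary values (1 at i = t - 1, 0 beyond),
-- so part (1) follows by induction on t, rows 1 and 2 being checked by
-- evaluation.  Part (2) is part (1) combined with the symmetry of d, and
-- parts (3)-(5) are short algebraic consequences of (1), (2) and the lower
-- recurrence of d.

open import Defs
open import Data.Bool using (Bool; true; false; if_then_else_; T; not)
open import Data.Bool.Properties using (T-∧)
open import Data.Nat using (ℕ; _∸_; zero; suc; z≤n; s≤s)
import Data.Nat.Properties as ℕP
open import Data.Integer using (ℤ; +_; -[1+_]; _+_; _-_; _*_; -_; _≤_; _≤ᵇ_; +≤+)
import Data.Integer.Properties as ℤP
open import Data.Product using (_×_; _,_)
open import Data.Sum using (inj₁; inj₂)
open import Data.Empty using (⊥-elim)
open import Function using (_∘_)
open import Function.Bundles using (Equivalence)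
open import Relation.Nullary using (¬_; yes; no)
open import Relation.Binary.PropositionalEquality
open import Relation.Binary.Definitions using (tri<; tri≈; tri>)
open import Data.Integer.Tactic.RingSolver using (solve-∀)

module N = Data.Nat

if-true : ∀ {A : Set} {b : Bool} {x y : A} → b ≡ true → (if b then x else y) ≡ x
if-true refl = refl

if-false : ∀ {A : Set} {b : Bool} {x y : A} → b ≡ false → (if b then x else y) ≡ y
if-false refl = refl

T⇒true : ∀ {b} → T b → b ≡ true
T⇒true {true} _ = refl

¬T⇒false : ∀ {b} → ¬ T b → b ≡ false
¬T⇒false {true}  ¬t = ⊥-elim (¬t _)
¬T⇒false {false} _  = refl

≤ᵇ-true : ∀ {m n} → m N.≤ n → (m N.≤ᵇ n) ≡ true
≤ᵇ-true = T⇒true ∘ ℕP.≤⇒≤ᵇ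

≤ᵇ-false : ∀ {m n} → n N.< m → (m N.≤ᵇ n) ≡ false
≤ᵇ-false {m} {n} n<m = ¬T⇒false (ℕP.<⇒≱ n<m ∘ ℕP.≤ᵇ⇒≤ m n)

==-refl : ∀ a → (a == a) ≡ true
==-refl a = T⇒true (Equivalence.from (T-∧ {a ≤ᵇ a} {a ≤ᵇ a}) (a≤ᵇa , a≤ᵇa))
  where
  a≤ᵇa : T (a ≤ᵇ a)
  a≤ᵇa = ℤP.≤⇒≤ᵇ (ℤP.≤-refl {a})

==-false : ∀ {a b} → a ≢ b → (a == b) ≡ false
==-false a≢b = ¬T⇒false λ t →
  let (a≤b , b≤a) = Equivalence.to T-∧ t in a≢b (ℤP.≤-antisym (ℤP.≤ᵇ⇒≤ a≤b) (ℤP.≤ᵇ⇒≤ b≤a))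

half-test : ∀ n t → (+ 2 * + n ≤ᵇ + t) ≡ (2 N.* n N.≤ᵇ t)
half-test n t = cong (_≤ᵇ + t) (sym (ℤP.pos-* 2 n))

d-lower-half : ∀ t n → 2 N.* n N.≤ t → d t (+ n) ≡ dc t (+ n)
d-lower-half t n 2n≤t =
  trans (if-false (cong not (≤ᵇ-true n≤t))) (if-true (trans (half-test n t) (≤ᵇ-true 2n≤t)))
  where
  n≤t : n N.≤ t
  n≤t = ℕP.≤-trans (ℕP.m≤m+n n _) 2n≤t

d-upper-half : ∀ t n → n N.≤ t → t N.< 2 N.* n → d t (+ n) ≡ dc t (+ t - + n)
d-upper-half t n n≤t t<2n =
  trans (if-false (cong not (≤ᵇ-true n≤t))) (if-false (trans (half-test n t) (≤ᵇ-false t<2n)))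

d-above : ∀ t n → t N.< n → d t (+ n) ≡ + 0
d-above t n t<n = if-true (cong not (≤ᵇ-false t<n))

d-at-zero : ∀ t → d t (+ 0) ≡ + 1
d-at-zero zero          = refl
d-at-zero (suc zero)    = refl
d-at-zero (suc (suc t)) = refl

-- Symmetry d_n(n + j) = d_j(n + j), first for n < j, where n lies in the
-- lower and j in the upper half, so both sides unfold to dc (n + j) n.
d-sym-ordered : ∀ n j → n N.< j → d (n N.+ j) (+ n) ≡ d (n N.+ j) (+ j)
d-sym-ordered n j n<j = begin
  d (n N.+ j) (+ n)                     ≡⟨ d-lower-half _ n 2n≤n+j ⟩
  dc (n N.+ j) (+ n)                    ≡⟨ cong (dc (n N.+ j)) (sym (n+j-j (+ n) (+ j))) ⟩
  dc (n N.+ j) (+ (n N.+ j) - + j)      ≡⟨ sym (d-upper-half _ j (ℕP.m≤n+m j n) n+j<2j) ⟩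
  d (n N.+ j) (+ j)                     ∎
  where
  open ≡-Reasoning
  2*-as-+ : ∀ k → 2 N.* k ≡ k N.+ k
  2*-as-+ k = cong (k N.+_) (ℕP.+-identityʳ k)
  2n≤n+j : 2 N.* n N.≤ n N.+ j
  2n≤n+j = subst (N._≤ n N.+ j) (sym (2*-as-+ n)) (ℕP.+-monoʳ-≤ n (ℕP.<⇒≤ n<j))
  n+j<2j : n N.+ j N.< 2 N.* j
  n+j<2j = subst (n N.+ j N.<_) (sym (2*-as-+ j)) (ℕP.+-monoˡ-< j n<j)
  n+j-j : ∀ a b → a + b - b ≡ a
  n+j-j = solve-∀

d-sym-ℕ : ∀ n j → d (n N.+ j) (+ n) ≡ d (n N.+ j) (+ j)
d-sym-ℕ n j with ℕP.<-cmp n j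
... | tri< n<j _ _ = d-sym-ordered n j n<j
... | tri≈ _ refl _ = refl
... | tri> _ _ j<n =
  subst (λ t → d t (+ n) ≡ d t (+ j)) (ℕP.+-comm j n) (sym (d-sym-ordered j n j<n))

beyond : ∀ t n m → + n + -[1+ m ] ≡ + t → t N.< n
beyond t n m n-m-1≡t = subst (t N.<_) (sym n≡t+1+m) (ℕP.m<m+n t (s≤s z≤n))
  where
  add-back : ∀ a b → a ≡ (a + b) - b
  add-back = solve-∀
  n≡t+1+m : n ≡ t N.+ suc m
  n≡t+1+m = ℤP.+-injective (trans (add-back (+ n) -[1+ m ]) (cong (_- -[1+ m ]) n-m-1≡t))

-- Symmetry d_i(t) = d_k(t) whenever i + k = t, for all integers i, k;
-- outside 0 ≤ i ≤ t both sides vanish.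
d-sym : ∀ t i k → i + k ≡ + t → d t i ≡ d t k
d-sym t (+ n) (+ j) n+j≡t with ℤP.+-injective n+j≡t
... | refl = d-sym-ℕ n j
d-sym t (+ n) -[1+ m ] n+k≡t = d-above t n (beyond t n m n+k≡t)
d-sym t -[1+ m ] (+ j) i+j≡t = sym (d-above t j (beyond t j m (trans (ℤP.+-comm (+ j) -[1+ m ]) i+j≡t)))
d-sym t -[1+ m ] -[1+ n ] ()

d-at-top : ∀ t → d t (+ t) ≡ + 1
d-at-top t = trans (d-sym t (+ t) (+ 0) (cong +_ (ℕP.+-identityʳ t))) (d-at-zero t)

midpoint : ∀ t i → + 2 * i ≡ + suc t → i + (i - + 1) ≡ + t
midpoint t i 2i≡t+1 = trans (regroup i) (cong (_- + 1) 2i≡t+1)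
  where
  regroup : ∀ i → i + (i - + 1) ≡ + 2 * i - + 1
  regroup = solve-∀

-- At 2i = t the definition uses 3d_{i-1}(t-1), which
-- matches since d_i(t-1) = d_{i-1}(t-1) by symmetry.
d-rec-lower : ∀ s i → + 2 * i ≤ + (2 N.+ s) →
  d (2 N.+ s) i ≡ + 2 * d (1 N.+ s) (i - + 1) + d (1 N.+ s) i - d s (i - + 1)
d-rec-lower s -[1+ n ] _ = refl
d-rec-lower zero (+ 0) _ = refl
d-rec-lower (suc s) (+ 0) _ = refl
d-rec-lower s (+ suc m) 2i≤t with 2 N.* suc m N.≤? suc s
... | yes 2i<t = trans (d-lower-half (2 N.+ s) (suc m) (ℤP.drop‿+≤+ 2i≤t)) (if-true (≤ᵇ-true 2i<t))
... | no 2i≮t = begin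
  d (2 N.+ s) (+ suc m)                     ≡⟨ d-lower-half (2 N.+ s) (suc m) (ℤP.drop‿+≤+ 2i≤t) ⟩
  dc (2 N.+ s) (+ suc m)                    ≡⟨ if-false (≤ᵇ-false (ℕP.≰⇒> 2i≮t)) ⟩
  + 3 * X - Z                               ≡⟨ split X Z ⟩
  + 2 * X + X - Z                           ≡⟨ cong (λ y → + 2 * X + y - Z) (sym middle-sym) ⟩
  + 2 * X + d (1 N.+ s) (+ suc m) - Z       ∎
  where
  open ≡-Reasoning
  X = d (1 N.+ s) (+ m)
  Z = d s (+ m)
  split : ∀ x z → + 3 * x - z ≡ + 2 * x + x - z
  split = solve-∀
  2i≡t : + 2 * + suc m ≡ + (2 N.+ s)
  2i≡t = cong +_ (ℕP.≤-antisym (ℤP.drop‿+≤+ 2i≤t) (ℕP.≰⇒> 2i≮t))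
  middle-sym : d (1 N.+ s) (+ suc m) ≡ X
  middle-sym = d-sym (1 N.+ s) (+ suc m) (+ m) (midpoint (1 N.+ s) (+ suc m) 2i≡t)

reflect-half : ∀ (T i : ℤ) → T ≤ + 2 * i → + 2 * (T - i) ≤ T
reflect-half T i T≤2i =
  subst₂ _≤_ (double-diff T i) (cancel T) (ℤP.+-monoʳ-≤ (T + T) (ℤP.neg-mono-≤ T≤2i))
  where
  double-diff : ∀ T i → T + T + - (+ 2 * i) ≡ + 2 * (T - i)
  double-diff = solve-∀
  cancel : ∀ T → T + T + - T ≡ T
  cancel = solve-∀

d-rec-upper : ∀ s i → + (2 N.+ s) ≤ + 2 * i →
  d (2 N.+ s) i ≡ d (1 N.+ s) (i - + 1) + + 2 * d (1 N.+ s) i - d s (i - + 1)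
d-rec-upper s i t≤2i = begin
  d (2 N.+ s) i
    ≡⟨ d-sym (2 N.+ s) i k (mirror₁ i (+ s)) ⟩
  d (2 N.+ s) k
    ≡⟨ d-rec-lower s k (reflect-half (+ (2 N.+ s)) i t≤2i) ⟩
  + 2 * d (1 N.+ s) (k - + 1) + d (1 N.+ s) k - d s (k - + 1)
    ≡⟨ cong₂ (λ x y → + 2 * x + y - d s (k - + 1))
         (d-sym (1 N.+ s) (k - + 1) i (mirror₂ i (+ s)))
         (d-sym (1 N.+ s) k (i - + 1) (mirror₃ i (+ s))) ⟩
  + 2 * d (1 N.+ s) i + d (1 N.+ s) (i - + 1) - d s (k - + 1)
    ≡⟨ cong (λ z → + 2 * d (1 N.+ s) i + d (1 N.+ s) (i - + 1) - z)
         (d-sym s (k - + 1) (i - + 1) (mirror₄ i (+ s))) ⟩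
  + 2 * d (1 N.+ s) i + d (1 N.+ s) (i - + 1) - d s (i - + 1)
    ≡⟨ reorder (d (1 N.+ s) i) (d (1 N.+ s) (i - + 1)) (d s (i - + 1)) ⟩
  d (1 N.+ s) (i - + 1) + + 2 * d (1 N.+ s) i - d s (i - + 1)
    ∎
  where
  open ≡-Reasoning
  k = + (2 N.+ s) - i
  mirror₁ : ∀ i S → i + ((+ 2 + S) - i) ≡ + 2 + S
  mirror₁ = solve-∀
  mirror₂ : ∀ i S → ((+ 2 + S) - i - + 1) + i ≡ + 1 + S
  mirror₂ = solve-∀
  mirror₃ : ∀ i S → ((+ 2 + S) - i) + (i - + 1) ≡ + 1 + S
  mirror₃ = solve-∀
  mirror₄ : ∀ i S → ((+ 2 + S) - i - + 1) + (i - + 1) ≡ S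
  mirror₄ = solve-∀
  reorder : ∀ a b c → + 2 * a + b - c ≡ b + + 2 * a - c
  reorder = solve-∀

shift≤ : ∀ T i → + 2 * i ≤ + 2 + T → + 2 * (i - + 1) ≤ T
shift≤ T i 2i≤T+2 = subst₂ _≤_ (double-pred i) (cancel T) (ℤP.+-monoˡ-≤ (- + 2) 2i≤T+2)
  where
  double-pred : ∀ i → + 2 * i + - + 2 ≡ + 2 * (i - + 1)
  double-pred = solve-∀
  cancel : ∀ T → + 2 + T + - + 2 ≡ T
  cancel = solve-∀

shift≥ : ∀ T i → + 2 + T ≤ + 2 * i → T ≤ + 2 * (i - + 1)
shift≥ T i T+2≤2i = subst₂ _≤_ (cancel T) (double-pred i) (ℤP.+-monoˡ-≤ (- + 2) T+2≤2i)
  where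
  double-pred : ∀ i → + 2 * i + - + 2 ≡ + 2 * (i - + 1)
  double-pred = solve-∀
  cancel : ∀ T → + 2 + T + - + 2 ≡ T
  cancel = solve-∀

-- Δd s i = d_i(s+1) - d_{i-1}(s), the right-hand side of part (1) at t = s + 1.
Δd : ℕ → ℤ → ℤ
Δd s i = d (suc s) i - d s (i - + 1)

Δd-rec-lower : ∀ r i → + 2 * i ≤ + (3 N.+ r) →
  Δd (2 N.+ r) i ≡ + 2 * Δd (1 N.+ r) (i - + 1) + Δd (1 N.+ r) i - Δd r (i - + 1)
Δd-rec-lower r i 2i≤t = begin
  d (3 N.+ r) i - A          ≡⟨ cong (_- A) (d-rec-lower (1 N.+ r) i 2i≤t) ⟩
  + 2 * A + B - E - A        ≡⟨ combine A B C E F (d-rec-lower r (i - + 1) 2[i-1]≤t-1) ⟩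
  + 2 * (A - C) + (B - E) - (E - F) ∎
  where
  open ≡-Reasoning
  A = d (2 N.+ r) (i - + 1)
  B = d (2 N.+ r) i
  C = d (1 N.+ r) (i - + 1 - + 1)
  E = d (1 N.+ r) (i - + 1)
  F = d r (i - + 1 - + 1)
  2[i-1]≤t-1 : + 2 * (i - + 1) ≤ + (2 N.+ r)
  2[i-1]≤t-1 = shift≤ (+ (2 N.+ r)) i (ℤP.≤-trans 2i≤t (+≤+ (ℕP.n≤1+n _)))
  combine : ∀ A B C E F → A ≡ + 2 * C + E - F →
            + 2 * A + B - E - A ≡ + 2 * (A - C) + (B - E) - (E - F)
  combine _ B C E F refl = identity B C E F
    where
    identity : ∀ B C E F → + 2 * (+ 2 * C + E - F) + B - E - (+ 2 * C + E - F)
                          ≡ + 2 * (+ 2 * C + E - F - C) + (B - E) - (E - F)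
    identity = solve-∀

Δd-rec-upper : ∀ r i → + (4 N.+ r) ≤ + 2 * i →
  Δd (2 N.+ r) i ≡ Δd (1 N.+ r) (i - + 1) + + 2 * Δd (1 N.+ r) i - Δd r (i - + 1)
Δd-rec-upper r i t+1≤2i = begin
  d (3 N.+ r) i - A          ≡⟨ cong (_- A) (d-rec-upper (1 N.+ r) i t≤2i) ⟩
  A + + 2 * B - E - A        ≡⟨ combine A B C E F (d-rec-upper r (i - + 1) t-1≤2[i-1]) ⟩
  (A - C) + + 2 * (B - E) - (E - F) ∎
  where
  open ≡-Reasoning
  A = d (2 N.+ r) (i - + 1)
  B = d (2 N.+ r) i
  C = d (1 N.+ r) (i - + 1 - + 1)
  E = d (1 N.+ r) (i - + 1)
  F = d r (i - + 1 - + 1)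
  t≤2i : + (3 N.+ r) ≤ + 2 * i
  t≤2i = ℤP.≤-trans (+≤+ (ℕP.n≤1+n _)) t+1≤2i
  t-1≤2[i-1] : + (2 N.+ r) ≤ + 2 * (i - + 1)
  t-1≤2[i-1] = shift≥ (+ (2 N.+ r)) i t+1≤2i
  combine : ∀ A B C E F → A ≡ C + + 2 * E - F →
            A + + 2 * B - E - A ≡ (A - C) + + 2 * (B - E) - (E - F)
  combine _ B C E F refl = identity B C E F
    where
    identity : ∀ B C E F → (C + + 2 * E - F) + + 2 * B - E - (C + + 2 * E - F)
                          ≡ (C + + 2 * E - F - C) + + 2 * (B - E) - (E - F)
    identity = solve-∀

below-edge : ∀ r m → m N.< suc r → + suc m ≢ + suc (suc r)
below-edge r m m<r+1 refl = ℕP.<-irrefl refl m<r+1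

d′-lower : ∀ r m → m N.< suc r → + 2 * + suc m ≤ + (3 N.+ r) →
  d′ (3 N.+ r) (+ suc m) ≡ + 2 * d′ (2 N.+ r) (+ m) + d′ (2 N.+ r) (+ suc m) - d′ (1 N.+ r) (+ m)
d′-lower r m m<r+1 2i≤t =
  trans (if-false (cong not (≤ᵇ-true (s≤s (ℕP.m≤n⇒m≤1+n m<r+1)))))
  (trans (if-false (==-false (below-edge r m m<r+1)))
         (if-true (T⇒true (ℤP.≤⇒≤ᵇ 2i≤t))))

d′-upper : ∀ r m → m N.< suc r → ¬ (+ 2 * + suc m ≤ + (3 N.+ r)) →
  d′ (3 N.+ r) (+ suc m) ≡ d′ (2 N.+ r) (+ m) + + 2 * d′ (2 N.+ r) (+ suc m) - d′ (1 N.+ r) (+ m)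
d′-upper r m m<r+1 2i≰t =
  trans (if-false (cong not (≤ᵇ-true (s≤s (ℕP.m≤n⇒m≤1+n m<r+1)))))
  (trans (if-false (==-false (below-edge r m m<r+1)))
         (if-false (¬T⇒false (2i≰t ∘ ℤP.≤ᵇ⇒≤))))

d′-edge : ∀ r → d′ (3 N.+ r) (+ (2 N.+ r)) ≡ + 1
d′-edge r = trans (if-false (cong not (≤ᵇ-true (ℕP.≤-refl {2 N.+ r}))))
                  (if-true (==-refl (+ (2 N.+ r))))

d′-beyond : ∀ r m → 2 N.+ r N.< suc m → d′ (3 N.+ r) (+ suc m) ≡ + 0
d′-beyond r m t-1<i = if-true (cong not (≤ᵇ-false t-1<i))

Δd-edge : ∀ s → Δd (suc s) (+ suc s) ≡ + 1
Δd-edge s = begin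
  d (2 N.+ s) (+ suc s) - P                                          ≡⟨ cong (_- P) (d-rec-upper s (+ suc s) t≤2i) ⟩
  P + + 2 * d (suc s) (+ suc s) - d s (+ s) - P                      ≡⟨ cong₂ (λ x y → P + + 2 * x - y - P) (d-at-top (suc s)) (d-at-top s) ⟩
  P + + 2 * + 1 - + 1 - P                                            ≡⟨ cancel P ⟩
  + 1                                                                ∎
  where
  open ≡-Reasoning
  P = d (suc s) (+ s)
  t≤2i : + (2 N.+ s) ≤ + 2 * + suc s
  t≤2i = +≤+ (subst (2 N.+ s N.≤_) (sym (ℕP.*-distribˡ-+ 2 1 s)) (ℕP.+-monoʳ-≤ 2 (ℕP.m≤n*m s 2)))
  cancel : ∀ P → P + + 2 * + 1 - + 1 - P ≡ + 1
  cancel = solve-∀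

Δd-above : ∀ s n → s N.≤ n → Δd s (+ suc n) ≡ + 0
Δd-above s n s≤n with ℕP.m≤n⇒m<n∨m≡n s≤n
... | inj₁ s<n  = cong₂ _-_ (d-above (suc s) (suc n) (s≤s s<n)) (d-above s n s<n)
... | inj₂ refl = cong₂ _-_ (d-at-top (suc s)) (d-at-top s)

part1-step : ∀ r → (∀ i → d′ (2 N.+ r) i ≡ Δd (1 N.+ r) i) → (∀ i → d′ (1 N.+ r) i ≡ Δd r i) →
             ∀ i → d′ (3 N.+ r) i ≡ Δd (2 N.+ r) i
part1-step r IH₁ IH₂ -[1+ n ] = refl
part1-step r IH₁ IH₂ (+ 0) = refl
part1-step r IH₁ IH₂ (+ suc m) with ℕP.<-cmp m (suc r)
... | tri≈ _ refl _ = trans (d′-edge r) (sym (Δd-edge (suc r)))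
... | tri> _ _ r+1<m = trans (d′-beyond r m (s≤s r+1<m)) (sym (Δd-above (2 N.+ r) m r+1<m))
... | tri< m<r+1 _ _ with + 2 * + suc m ℤP.≤? + (3 N.+ r)
...   | yes 2i≤t = begin
  d′ (3 N.+ r) (+ suc m)
    ≡⟨ d′-lower r m m<r+1 2i≤t ⟩
  + 2 * d′ (2 N.+ r) (+ m) + d′ (2 N.+ r) (+ suc m) - d′ (1 N.+ r) (+ m)
    ≡⟨ cong₂ _-_ (cong₂ (λ x y → + 2 * x + y) (IH₁ (+ m)) (IH₁ (+ suc m))) (IH₂ (+ m)) ⟩
  + 2 * Δd (1 N.+ r) (+ m) + Δd (1 N.+ r) (+ suc m) - Δd r (+ m)
    ≡⟨ sym (Δd-rec-lower r (+ suc m) 2i≤t) ⟩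
  Δd (2 N.+ r) (+ suc m)
    ∎
  where open ≡-Reasoning
...   | no 2i≰t = begin
  d′ (3 N.+ r) (+ suc m)
    ≡⟨ d′-upper r m m<r+1 2i≰t ⟩
  d′ (2 N.+ r) (+ m) + + 2 * d′ (2 N.+ r) (+ suc m) - d′ (1 N.+ r) (+ m)
    ≡⟨ cong₂ _-_ (cong₂ (λ x y → x + + 2 * y) (IH₁ (+ m)) (IH₁ (+ suc m))) (IH₂ (+ m)) ⟩
  Δd (1 N.+ r) (+ m) + + 2 * Δd (1 N.+ r) (+ suc m) - Δd r (+ m)
    ≡⟨ sym (Δd-rec-upper r (+ suc m) (ℤP.i<j⇒suc[i]≤j (ℤP.≰⇒> 2i≰t))) ⟩
  Δd (2 N.+ r) (+ suc m)
    ∎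
  where open ≡-Reasoning

part1 : ∀ s i → d′ (suc s) i ≡ Δd s i
part1 zero -[1+ n ] = refl
part1 zero (+ 0) = refl
part1 zero (+ 1) = refl
part1 zero (+ suc (suc k)) = refl
part1 (suc zero) -[1+ n ] = refl
part1 (suc zero) (+ 0) = refl
part1 (suc zero) (+ 1) = refl
part1 (suc zero) (+ 2) = refl
part1 (suc zero) (+ suc (suc (suc k))) = refl
part1 (suc (suc r)) = part1-step r (part1 (suc r)) (part1 r)

part1-succ : ∀ s i → d′ (suc s) (i + + 1) ≡ d (suc s) (i + + 1) - d s i
part1-succ s i = trans (part1 s (i + + 1)) (cong (λ k → d (suc s) (i + + 1) - d s k) (pred-succ i))
  where
  pred-succ : ∀ i → i + + 1 - + 1 ≡ i
  pred-succ = solve-∀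

-- Part (2): d″_j(t) = d_{j+1}(t) - d_{j+1}(t-1); stated for any i = j + 1.
-- By definition d″_j(t) = d′_{t-1-j}(t), and part (1) plus symmetry of d
-- turn the indices t-1-j and t-2-j into j + 1.
part2 : ∀ s j i → j + + 1 ≡ i → d″ (suc s) j ≡ d (suc s) i - d s i
part2 s j _ refl = trans (part1 s k)
  (cong₂ _-_ (d-sym (suc s) k (j + + 1) (mirror₁ j (+ s)))
             (d-sym s (k - + 1) (j + + 1) (mirror₂ j (+ s))))
  where
  k = + suc s - + 1 - j
  mirror₁ : ∀ j S → (+ 1 + S) - + 1 - j + (j + + 1) ≡ + 1 + S
  mirror₁ = solve-∀
  mirror₂ : ∀ j S → (+ 1 + S) - + 1 - j - + 1 + (j + + 1) ≡ S
  mirror₂ = solve-∀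

d-rec-lower-succ : ∀ s i → + 2 * i ≤ + s →
  d (2 N.+ s) (i + + 1) ≡ + 2 * d (1 N.+ s) i + d (1 N.+ s) (i + + 1) - d s i
d-rec-lower-succ s i 2i≤s = subst (λ k → d (2 N.+ s) (i + + 1) ≡ + 2 * d (1 N.+ s) k + d (1 N.+ s) (i + + 1) - d s k)
  (pred-succ i) (d-rec-lower s (i + + 1) 2[i+1]≤s+2)
  where
  pred-succ : ∀ i → i + + 1 - + 1 ≡ i
  pred-succ = solve-∀
  double-succ : ∀ i → + 2 + + 2 * i ≡ + 2 * (i + + 1)
  double-succ = solve-∀
  2[i+1]≤s+2 : + 2 * (i + + 1) ≤ + (2 N.+ s)
  2[i+1]≤s+2 = subst (_≤ + (2 N.+ s)) (double-succ i) (ℤP.+-monoʳ-≤ (+ 2) 2i≤s)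

-- Part (3): d_i(t-1) = d′_{i+1}(t) - d′_{i+1}(t-1) for 2i ≤ t - 2.  By part (1)
-- the right side is Δd_{i+1}(t-1) - Δd_{i+1}(t-2), which the recurrence for
-- d_{i+1}(t) reduces to d_i(t-1); row t = 1 only has negative i.
part3 : ∀ s i → + 2 * i ≤ + suc s - + 2 → d s i ≡ d′ (suc s) (i + + 1) - d′ s (i + + 1)
part3 zero (+ zero) ()
part3 zero (+ suc n) ()
part3 zero -[1+ zero ] _ = refl
part3 zero -[1+ suc n ] _ = refl
part3 (suc r) i 2i≤t-2 = sym (begin
  d′ (2 N.+ r) (i + + 1) - d′ (1 N.+ r) (i + + 1)
    ≡⟨ cong₂ _-_ (part1-succ (1 N.+ r) i) (part1-succ r i) ⟩
  d (2 N.+ r) (i + + 1) - X - (Y - Z)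
    ≡⟨ cong (λ w → w - X - (Y - Z)) (d-rec-lower-succ r i 2i≤t-2) ⟩
  + 2 * X + Y - Z - X - (Y - Z)
    ≡⟨ cancel X Y Z ⟩
  X ∎)
  where
  open ≡-Reasoning
  X = d (1 N.+ r) i
  Y = d (1 N.+ r) (i + + 1)
  Z = d r i
  cancel : ∀ X Y Z → + 2 * X + Y - Z - X - (Y - Z) ≡ X
  cancel = solve-∀

-- Part (4): d_i(t-1) = d″_i(t) - d″_{i-1}(t-1) for 2i ≤ t - 2, the same
-- computation with part (2) in place of part (1).
part4 : ∀ s i → + 2 * i ≤ + suc s - + 2 → d s i ≡ d″ (suc s) i - d″ s (i - + 1)
part4 zero (+ zero) ()
part4 zero (+ suc n) ()
part4 zero -[1+ n ] _ = refl
part4 (suc r) i 2i≤t-2 = sym (begin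
  d″ (2 N.+ r) i - d″ (1 N.+ r) (i - + 1)
    ≡⟨ cong₂ _-_ (part2 (1 N.+ r) i (i + + 1) refl) (part2 r (i - + 1) i (succ-pred i)) ⟩
  d (2 N.+ r) (i + + 1) - Y - (X - Z)
    ≡⟨ cong (λ w → w - Y - (X - Z)) (d-rec-lower-succ r i 2i≤t-2) ⟩
  + 2 * X + Y - Z - Y - (X - Z)
    ≡⟨ cancel X Y Z ⟩
  X ∎)
  where
  open ≡-Reasoning
  X = d (1 N.+ r) i
  Y = d (1 N.+ r) (i + + 1)
  Z = d r i
  succ-pred : ∀ i → i - + 1 + + 1 ≡ i
  succ-pred = solve-∀
  cancel : ∀ X Y Z → + 2 * X + Y - Z - Y - (X - Z) ≡ X
  cancel = solve-∀

-- Part (5): d_i(t-1) = d′_i(t) - d″_{i-2}(t-1) for 2i ≤ t, via parts (1), (2)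
-- and the recurrence for d_i(t); for t = 1 only i ≤ 0 occurs.
part5 : ∀ s i → + 2 * i ≤ + suc s → d s i ≡ d′ (suc s) i - d″ s (i - + 2)
part5 zero (+ zero) _ = refl
part5 zero (+ suc n) (+≤+ (s≤s 2n+1≤0)) with () ← ℕP.≤-trans (ℕP.m≤n+m (suc (n N.+ 0)) n) 2n+1≤0
part5 zero -[1+ n ] _ = refl
part5 (suc r) i 2i≤t = sym (begin
  d′ (2 N.+ r) i - d″ (1 N.+ r) (i - + 2)
    ≡⟨ cong₂ _-_ (part1 (1 N.+ r) i) (part2 r (i - + 2) (i - + 1) (succ-pred₂ i)) ⟩
  d (2 N.+ r) i - W - (W - V)
    ≡⟨ cong (λ w → w - W - (W - V)) (d-rec-lower r i 2i≤t) ⟩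
  + 2 * W + X - V - W - (W - V)
    ≡⟨ cancel X W V ⟩
  X ∎)
  where
  open ≡-Reasoning
  X = d (1 N.+ r) i
  W = d (1 N.+ r) (i - + 1)
  V = d r (i - + 1)
  succ-pred₂ : ∀ i → i - + 2 + + 1 ≡ i - + 1
  succ-pred₂ = solve-∀
  cancel : ∀ X W V → + 2 * W + X - V - W - (W - V) ≡ X
  cancel = solve-∀

mainTheorem1 : (t : ℕ) → 1 Data.Nat.≤ t →
    (∀ (i : ℤ) → d′ t i ≡ d t i - d (t ∸ 1) (i - + 1))
    × (∀ (i : ℤ) → d″ t i ≡ d t (i + + 1) - d (t ∸ 1) (i + + 1))
    × (∀ (i : ℤ) → + 2 * i ≤ + t - + 2 → d (t ∸ 1) i ≡ d′ t (i + + 1) - d′ (t ∸ 1) (i + + 1))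
    × (∀ (i : ℤ) → + 2 * i ≤ + t - + 2 → d (t ∸ 1) i ≡ d″ t i - d″ (t ∸ 1) (i - + 1))
    × (∀ (i : ℤ) → + 2 * i ≤ + t → d (t ∸ 1) i ≡ d′ t i - d″ (t ∸ 1) (i - + 2))
mainTheorem1 (suc s) _ = part1 s , (λ i → part2 s i (i + + 1) refl) , part3 s , part4 s , part5 s
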